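{- Let $m$ be a positive integer such that there exists a perfect Latin square of order $m$ (i.e. a perfect Latin rectangle of size $m\times m$). If there exists a perfect Latin rectangle of size $m\times n$, then there also exists a perfect Latin rectangle of size $m\times (n+m-1)$.
   Context: Let $m\le n$ be positive integers. A Latin rectangle $R$ of size $m\times n$ is an $m\times n$ array filled with symbols from an alphabet $\Sigma_R$ of $n$ symbols such that each row contains every symbol of $\Sigma_R$ exactly once and each column contains $m$ distinct symbols; $R(a,c)$ denotes the symbol in row $a$, column $c$. For two rows $a,b$, the permutation $R_{a,b}$ of $\Sigma_R$ is defined by $R_{a,b}(x)=y$ iff there is a column $c$ with $R(a,c)=x$ and $R(b,c)=y$. The pair $(a,b)$ is perfect if $R_{a,b}$ is a cyclic permutation (a single cycle of length $n$), and $R$ is a perfect Latin rectangle if every pair of distinct rows is perfect. A Latin square of order $m$ is a Latin rectangle of size $m\times m$. -}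

module Defs where

open import Data.Nat using (ℕ; _+_; _∸_)
open import Data.Fin using (Fin)
open import Data.Product using (∃; proj₁; proj₂; _×_)
open import Function using (_∘_)
open import Function.Definitions using (Injective; Bijective)
open import Relation.Binary.PropositionalEquality using (_≡_; _≢_)
open import Relation.Nullary using (¬_)

iter : {A : Set} → (A → A) → ℕ → A → A
iter f ℕ.zero x = x
iter f (ℕ.suc k) x = f (iter f k x)

-- A permutation σ of a finite set is cyclic (a single cycle through all
-- elements) iff every element reaches every other element by iterating σ.
IsCyclic : {n : ℕ} → (Fin n → Fin n) → Set
IsCyclic σ = ∀ x y → ∃ λ k → iter σ k x ≡ y

record LatinRectangle (m n : ℕ) : Set where
  field
    entry   : Fin m → Fin n → Fin n
    rowBij  : ∀ a → Bijective _≡_ _≡_ (entry a)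
    colInj  : ∀ c → Injective _≡_ _≡_ (λ a → entry a c)

  colOf : Fin m → Fin n → Fin n
  colOf a x = proj₁ (proj₂ (rowBij a) x)

  rowPerm : Fin m → Fin m → Fin n → Fin n
  rowPerm a b x = entry b (colOf a x)

open LatinRectangle public

IsPerfect : {m n : ℕ} → LatinRectangle m n → Set
IsPerfect {m} R = ∀ (a b : Fin m) → a ≢ b → IsCyclic (rowPerm R a b)

module Submission where

-- Let S be a perfect m × m Latin square and R a perfect m × n Latin
-- rectangle, m = k + 1 and n = n' + 1.  The new m × (n + m - 1) rectangle T
-- has the columns of R followed by the columns 1 … k of S; its symbols are
-- the symbols 1 … n' of R together with all symbols of S.  In row a, every
-- occurrence of symbol 0 of R is replaced by S(a,0).
--
-- For rows a ≠ b, the permutation T_{a,b} is obtained from the cycle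
-- R_{a,b} by replacing its element 0 with the path S(b,0) → … → S(a,0) of
-- the cycle S_{a,b}; splicing one cycle into another yields a single cycle.

open import Defs
open import Data.Nat using (ℕ; _+_; _∸_; _≤_; _>_; zero; suc)
open import Data.Nat.Properties using (+-suc)
open import Data.Fin using (Fin; zero; suc)
open import Data.Fin.Properties using (_≟_; 0≢1+n; +↔⊎)
import Data.Fin.Properties as Fin
open import Data.Product using (Σ; ∃; _,_; proj₁; proj₂)
open import Data.Sum using (_⊎_; inj₁; inj₂)
open import Data.Sum.Properties using (inj₁-injective; inj₂-injective)
open import Data.Empty using (⊥-elim)
open import Function using (_∘_; _↔_; Inverse; Bijection)
open import Function.Definitions using (Injective; Bijective; StrictlySurjective)
open import Function.Properties.Inverse using (↔-sym; ↔⇒⤖)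
open import Function.Consequences.Propositional using (strictlySurjective⇒surjective)
import Function.Construct.Composition as Comp
open import Relation.Binary.Definitions using (DecidableEquality)
open import Relation.Binary.PropositionalEquality
open import Relation.Nullary using (yes; no)

Reaches : {A : Set} → (A → A) → A → A → Set
Reaches τ x y = ∃ λ k → iter τ k x ≡ y

Cyclic : {A : Set} → (A → A) → Set
Cyclic τ = ∀ x y → Reaches τ x y

iter-+ : {A : Set} (τ : A → A) (k j : ℕ) (x : A) →
         iter τ (k + j) x ≡ iter τ k (iter τ j x)
iter-+ τ zero j x = refl
iter-+ τ (suc k) j x = cong τ (iter-+ τ k j x)

iter-suc : {A : Set} (τ : A → A) (k : ℕ) (x : A) → iter τ (suc k) x ≡ iter τ k (τ x)
iter-suc τ zero x = refl
iter-suc τ (suc k) x = cong τ (iter-suc τ k x)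

reaches-refl : {A : Set} {τ : A → A} {x : A} → Reaches τ x x
reaches-refl = 0 , refl

reaches-step : {A : Set} {τ : A → A} {x y : A} → τ x ≡ y → Reaches τ x y
reaches-step p = 1 , p

reaches-trans : {A : Set} {τ : A → A} {x y z : A} →
                Reaches τ x y → Reaches τ y z → Reaches τ x z
reaches-trans {τ = τ} {x} (j , p) (k , q) =
  k + j , trans (iter-+ τ k j x) (trans (cong (iter τ k) p) q)

orbit-induction : {A : Set} {σ : A → A} → Cyclic σ → (P : A → Set) (x₀ : A) →
                  P x₀ → (∀ x → P x → P (σ x)) → ∀ y → P y
orbit-induction {σ = σ} σ-cyc P x₀ base step y =
  subst P (proj₂ (σ-cyc x₀ y)) (along (proj₁ (σ-cyc x₀ y)))
  where
    along : ∀ k → P (iter σ k x₀)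
    along zero = base
    along (suc k) = step _ (along k)

-- τ follows σ along f at every point except s (the point where the orbit
-- of σ is cut open).
record Simulates {A C : Set} (τ : C → C) (σ : A → A) (f : A → C) (s : A) : Set where
  field
    follows : ∀ x → x ≢ s → τ (f x) ≡ f (σ x)

open Simulates

module _ {A C : Set} (_≟A_ : DecidableEquality A) {σ : A → A} (σ-cyc : Cyclic σ)
         {τ : C → C} {f : A → C} {s : A} (sim : Simulates τ σ f s) where

  -- Following the σ-orbit of x until it hits s, τ carries f x to f s.
  reaches-cut : ∀ x → Reaches τ (f x) (f s)
  reaches-cut x = walk (proj₁ (σ-cyc x s)) x (proj₂ (σ-cyc x s))
    where
      walk : ∀ k x → iter σ k x ≡ s → Reaches τ (f x) (f s)
      walk zero x refl = reaches-refl
      walk (suc k) x p with x ≟A s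
      ... | yes refl = reaches-refl
      ... | no x≢s = reaches-trans (reaches-step (follows sim x x≢s))
                       (walk k (σ x) (trans (sym (iter-suc σ k x)) p))

  reaches-image : ∀ {c} → Reaches τ c (f (σ s)) → ∀ y → Reaches τ c (f y)
  reaches-image {c} start = orbit-induction σ-cyc (Reaches τ c ∘ f) (σ s) start step
    where
      step : ∀ x → Reaches τ c (f x) → Reaches τ c (f (σ x))
      step x c↝fx with x ≟A s
      ... | yes refl = start
      ... | no x≢s = reaches-trans c↝fx (reaches-step (follows sim x x≢s))

-- Splicing: a cycle σ is cut open at s, a cycle ρ is cut open at t, and the
-- path ρ t → … → t is inserted in place of s.  If τ realises this (it
-- follows σ through f and ρ through g away from the cuts, f s is the start
-- ρ t of the inserted path, τ leaves its end t towards σ s) and every point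
-- is an image of f or g, then τ is cyclic.
splice : {A B C : Set} → DecidableEquality A → DecidableEquality B →
         {σ : A → A} {ρ : B → B} {τ : C → C} {f : A → C} {g : B → C} {s : A} {t : B} →
         Cyclic σ → Cyclic ρ → Simulates τ σ f s → Simulates τ ρ g t →
         f s ≡ g (ρ t) → τ (g t) ≡ f (σ s) →
         (∀ z → (∃ λ x → f x ≡ z) ⊎ (∃ λ w → g w ≡ z)) →
         Cyclic τ
splice _≟A_ _≟B_ {τ = τ} {f} {g} {s} {t} σ-cyc ρ-cyc simσ simρ enter leave cover z z′ =
  reaches-trans (to-hub z) (from-hub z′)
  where
    -- g t is a hub: every point reaches it and it reaches every point.
    to-hub : ∀ z → Reaches τ z (g t)
    to-hub z with cover z
    ... | inj₁ (x , refl) =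
          reaches-trans (subst (Reaches τ (f x)) enter (reaches-cut _≟A_ σ-cyc simσ x))
                        (reaches-cut _≟B_ ρ-cyc simρ _)
    ... | inj₂ (w , refl) = reaches-cut _≟B_ ρ-cyc simρ w

    from-hub-f : ∀ x → Reaches τ (g t) (f x)
    from-hub-f = reaches-image _≟A_ σ-cyc simσ (reaches-step leave)

    from-hub-g : ∀ w → Reaches τ (g t) (g w)
    from-hub-g = reaches-image _≟B_ ρ-cyc simρ (subst (Reaches τ (g t)) enter (from-hub-f s))

    from-hub : ∀ z → Reaches τ (g t) z
    from-hub z with cover z
    ... | inj₁ (x , refl) = from-hub-f x
    ... | inj₂ (w , refl) = from-hub-g w

row-injective : ∀ {m n} (R : LatinRectangle m n) a → Injective _≡_ _≡_ (entry R a)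
row-injective R a = proj₁ (rowBij R a)

colOf-spec : ∀ {m n} (R : LatinRectangle m n) a x → entry R a (colOf R a x) ≡ x
colOf-spec R a x = proj₂ (proj₂ (rowBij R a) x) refl

rowPerm-column : ∀ {m n} (R : LatinRectangle m n) a b {c x} →
                 entry R a c ≡ x → rowPerm R a b x ≡ entry R b c
rowPerm-column R a b {c} {x} p =
  cong (entry R b) (row-injective R a (trans (colOf-spec R a x) (sym p)))

record LatinTable (m : ℕ) (Col Sym : Set) : Set where
  field
    cell             : Fin m → Col → Sym
    cell-injective   : ∀ a → Injective _≡_ _≡_ (cell a)
    cell-surjective  : ∀ a → StrictlySurjective _≡_ (cell a)
    column-injective : ∀ X → Injective _≡_ _≡_ (λ a → cell a X)

open LatinTable

module Relabel {m n : ℕ} {Col Sym : Set} (L : LatinTable m Col Sym)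
               (columns : Fin n ↔ Col) (symbols : Fin n ↔ Sym) where

  open Inverse

  toFin : Sym → Fin n
  toFin = from symbols

  toFin-bijective : Bijective _≡_ _≡_ toFin
  toFin-bijective = Bijection.bijective (↔⇒⤖ (↔-sym symbols))

  cell-bijective : ∀ a → Bijective _≡_ _≡_ (cell L a)
  cell-bijective a = cell-injective L a , strictlySurjective⇒surjective (cell-surjective L a)

  rectangle : LatinRectangle m n
  rectangle = record
    { entry  = λ a → toFin ∘ cell L a ∘ to columns
    ; rowBij = λ a → Comp.bijective _≡_ _≡_ _≡_ (Bijection.bijective (↔⇒⤖ columns))
                       (Comp.bijective _≡_ _≡_ _≡_ (cell-bijective a) toFin-bijective)
    ; colInj = λ c → column-injective L (to columns c) ∘ proj₁ toFin-bijective
    }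

  rowPerm-rectangle : ∀ a b X → rowPerm rectangle a b (toFin (cell L a X)) ≡ toFin (cell L b X)
  rowPerm-rectangle a b X =
    trans (rowPerm-column rectangle a b (in-column a)) (in-column b)
    where
      in-column : ∀ a → entry rectangle a (from columns X) ≡ toFin (cell L a X)
      in-column a = cong (toFin ∘ cell L a) (strictlyInverseˡ columns X)

module Extension {k n' : ℕ} (S : LatinRectangle (suc k) (suc k))
                 (R : LatinRectangle (suc k) (suc n')) where

  -- Columns: those of R, then the columns 1 … k of S.
  Col : Set
  Col = Fin (suc n') ⊎ Fin k

  -- Symbols: 1 … n' of R (shifted down), then those of S.
  Sym : Set
  Sym = Fin n' ⊎ Fin (suc k)

  replaceZero : Fin (suc k) → Fin (suc n') → Sym
  replaceZero a zero    = inj₂ (entry S a zero)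
  replaceZero a (suc x) = inj₁ x

  table : Fin (suc k) → Col → Sym
  table a (inj₁ c) = replaceZero a (entry R a c)
  table a (inj₂ j) = inj₂ (entry S a (suc j))

  replaceZero-cancel : ∀ {a b x y} → replaceZero a x ≡ replaceZero b y → x ≡ y
  replaceZero-cancel {x = zero}  {zero}  _  = refl
  replaceZero-cancel {x = suc x} {suc y} eq = cong suc (inj₁-injective eq)
  replaceZero-cancel {x = zero}  {suc y} ()
  replaceZero-cancel {x = suc x} {zero}  ()

  -- The R-part and the S-part of a row share no symbol: the only S-symbol in
  -- the R-part is S(a,0), which the S-part omits.
  parts-disjoint : ∀ a c j → table a (inj₁ c) ≢ table a (inj₂ j)
  parts-disjoint a c j eq with entry R a c
  ... | zero = 0≢1+n (row-injective S a (inj₂-injective eq))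
  parts-disjoint a c j () | suc _

  table-injective : ∀ a → Injective _≡_ _≡_ (table a)
  table-injective a {inj₁ c} {inj₁ c′} eq = cong inj₁ (row-injective R a (replaceZero-cancel eq))
  table-injective a {inj₁ c} {inj₂ j}  eq = ⊥-elim (parts-disjoint a c j eq)
  table-injective a {inj₂ j} {inj₁ c}  eq = ⊥-elim (parts-disjoint a c j (sym eq))
  table-injective a {inj₂ j} {inj₂ j′} eq =
    cong inj₂ (Fin.suc-injective (row-injective S a (inj₂-injective eq)))

  table-surjective : ∀ a → StrictlySurjective _≡_ (table a)
  table-surjective a (inj₁ x) = inj₁ (colOf R a (suc x)) , cong (replaceZero a) (colOf-spec R a (suc x))
  table-surjective a (inj₂ w) = in-column (colOf S a w) (colOf-spec S a w)
    where
      in-column : ∀ d → entry S a d ≡ w → ∃ λ X → table a X ≡ inj₂ w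
      in-column zero    p = inj₁ (colOf R a zero) , trans (cong (replaceZero a) (colOf-spec R a zero)) (cong inj₂ p)
      in-column (suc j) p = inj₂ j , cong inj₂ p

  column-injective-table : ∀ X → Injective _≡_ _≡_ (λ a → table a X)
  column-injective-table (inj₁ c) eq = colInj R c (replaceZero-cancel eq)
  column-injective-table (inj₂ j) eq = colInj S (suc j) (inj₂-injective eq)

  latinTable : LatinTable (suc k) Col Sym
  latinTable = record
    { cell             = table
    ; cell-injective   = table-injective
    ; cell-surjective  = table-surjective
    ; column-injective = column-injective-table
    }

  -- Both sets have n' + (k+1) = n + m - 1 elements.
  columns : Fin (n' + suc k) ↔ Col
  columns = subst (λ p → Fin p ↔ Col) (sym (+-suc n' k)) +↔⊎

  symbols : Fin (n' + suc k) ↔ Sym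
  symbols = +↔⊎

  open Relabel latinTable columns symbols

  extension : LatinRectangle (suc k) (n' + suc k)
  extension = rectangle

  -- T_{a,b} is R_{a,b} with 0 replaced by the path S(b,0) → … → S(a,0) of
  -- S_{a,b}: the hypotheses of the splicing lemma.
  extension-perfect : IsPerfect S → IsPerfect R → IsPerfect extension
  extension-perfect S-perfect R-perfect a b a≢b =
    splice _≟_ _≟_ (R-perfect a b a≢b) (S-perfect a b a≢b) along-R along-S enter leave cover
    where
      τ : Fin (n' + suc k) → Fin (n' + suc k)
      τ = rowPerm extension a b

      u : Fin (suc k)
      u = entry S a zero

      -- The symbols of R and of S inside the new alphabet; R's 0 is placed
      -- at S(b,0), where the inserted path starts.
      fromR : Fin (suc n') → Fin (n' + suc k)
      fromR = toFin ∘ replaceZero b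

      fromS : Fin (suc k) → Fin (n' + suc k)
      fromS = toFin ∘ inj₂

      τ-on-R : ∀ x → τ (toFin (replaceZero a x)) ≡ fromR (rowPerm R a b x)
      τ-on-R x = trans (cong (τ ∘ toFin ∘ replaceZero a) (sym (colOf-spec R a x)))
                       (rowPerm-rectangle a b (inj₁ (colOf R a x)))

      τ-on-S : ∀ w d → entry S a d ≡ w → w ≢ u → τ (fromS w) ≡ fromS (rowPerm S a b w)
      τ-on-S w zero    p    w≢u = ⊥-elim (w≢u (sym p))
      τ-on-S w (suc j) refl _   = trans (rowPerm-rectangle a b (inj₂ j))
                                        (cong fromS (sym (rowPerm-column S a b refl)))

      along-R : Simulates τ (rowPerm R a b) fromR zero
      along-R = record { follows = λ { zero 0≢0 → ⊥-elim (0≢0 refl) ; (suc x) _ → τ-on-R (suc x) } }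

      along-S : Simulates τ (rowPerm S a b) fromS u
      along-S = record { follows = λ w → τ-on-S w (colOf S a w) (colOf-spec S a w) }

      enter : fromR zero ≡ fromS (rowPerm S a b u)
      enter = cong fromS (sym (rowPerm-column S a b refl))

      leave : τ (fromS u) ≡ fromR (rowPerm R a b zero)
      leave = τ-on-R zero

      cover : ∀ z → (∃ λ x → fromR x ≡ z) ⊎ (∃ λ w → fromS w ≡ z)
      cover z with Inverse.to symbols z | Inverse.strictlyInverseʳ symbols z
      ... | inj₁ x | p = inj₁ (suc x , p)
      ... | inj₂ w | p = inj₂ (w , p)

proposition1 : (m n : ℕ) → m > 0 → m ≤ n →
    Σ (LatinRectangle m m) IsPerfect →
    Σ (LatinRectangle m n) IsPerfect →
    Σ (LatinRectangle m (n + m ∸ 1)) IsPerfect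
proposition1 (suc k) (suc n') _ _ (S , S-perfect) (R , R-perfect) =
  extension , extension-perfect S-perfect R-perfect
  where open Extension S R
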